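{- Let $n,s$ be positive integers with $2s\le n$ and let $L=[s]=\{1,\ldots,s\}$. Let $\mathcal{F}\subseteq 2^{[n]}$ be $L$-close Sperner (respectively, $L$-differencing Sperner). Then there is $\mathcal{F}'\subseteq 2^{[n]}$ such that $|\mathcal{F}'|=|\mathcal{F}|$, $s\le|A|\le n-s$ for each $A\in\mathcal{F}'$, and $\mathcal{F}'$ is $L$-close Sperner (respectively, $L$-differencing Sperner).
   Context: $[n]=\{1,\ldots,n\}$, $2^{[n]}$ is the family of all subsets of $[n]$. A family $\mathcal{F}\subseteq 2^{[n]}$ is $L$-differencing Sperner if $|A\setminus B|\in L$ for all distinct $A,B\in\mathcal{F}$, and $L$-close Sperner if $\min\{|A\setminus B|,|B\setminus A|\}\in L$ for all distinct $A,B\in\mathcal{F}$. -}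

module Defs where

open import Data.Nat using (ℕ; _≤_; _∸_; _⊓_; suc)
open import Data.Fin.Subset using (Subset; _─_; ∣_∣)
open import Data.List using (List; length)
open import Data.List.Membership.Propositional using (_∈_)
open import Data.List.Relation.Unary.Unique.Propositional using (Unique)
open import Relation.Binary.PropositionalEquality using (_≡_)
open import Relation.Nullary using (¬_)

-- A family F ⊆ 2^[n] is represented as a duplicate-free list of subsets
-- of Fin n (Subset n = Vec Bool n); |F| = length of the list.

InInterval : ℕ → ℕ → Set
InInterval s k = 1 ≤ k × k ≤ s
  where open import Data.Product using (_×_)

DifferencingSperner : ∀ {n} → ℕ → List (Subset n) → Set
DifferencingSperner s F =
  ∀ {A B} → A ∈ F → B ∈ F → ¬ A ≡ B → InInterval s ∣ A ─ B ∣

CloseSperner : ∀ {n} → ℕ → List (Subset n) → Set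
CloseSperner s F =
  ∀ {A B} → A ∈ F → B ∈ F → ¬ A ≡ B → InInterval s (∣ A ─ B ∣ ⊓ ∣ B ─ A ∣)

MiddleSized : ∀ {n} → ℕ → List (Subset n) → Set
MiddleSized {n} s F = ∀ {A} → A ∈ F → s ≤ ∣ A ∣ × ∣ A ∣ ≤ n ∸ s
  where open import Data.Product using (_×_)

{-# OPTIONS --safe #-}

-- In the symmetric chain decomposition of 2^[n], the successor map up sends every A with
-- 2|A| < n injectively to a set up A ⊃ A with one more element. Replacing the members of size t
-- by their successors, for t = 0, 1, …, s - 1 in turn, keeps the family duplicate-free and keeps
-- the condition: for a lifted A and a kept B we get |A ─ B| ≤ |up A ─ B| ≤ |up A| ≤ s and
-- 1 ≤ |B ─ up A| ≤ |B ─ A|. Complementation swaps |A ─ B| and |B ─ A|, so doing the same to the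
-- complemented family also removes the members of size above n - s.
module Submission where

open import Defs
open import Data.Nat using (ℕ; zero; suc; pred; _+_; _*_; _∸_; _⊓_; _≤_; _<_; z≤n; s≤s; z<s)
open import Data.Nat.Properties
open import Data.Product using (_×_; _,_; proj₁; proj₂; Σ-syntax)
open import Data.Fin.Subset using (Subset; inside; outside; _─_; ∣_∣; ∁; _⊆_; Empty)
  renaming (_∈_ to _∈ₛ_; _∉_ to _∉ₛ_)
open import Data.Fin.Subset.Properties
  using (drop-there; out⊆; in⊆in; ⊆-refl; x∈p∧x∉q⇒x∈p─q; Empty-unique; ∣⊥∣≡0; p⊆q⇒∣p∣≤∣q∣;
         ∣p─q∣≤∣p∣; ∣∁p∣≡n∸∣p∣; ∣p∣≤n; ∪-∩-booleanAlgebra)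
import Algebra.Lattice.Properties.BooleanAlgebra as BooleanAlgebraProperties
open import Data.Fin.Base using (zero)
open import Data.Vec.Base using ([]; _∷_; here; there)
open import Data.Vec.Properties using (∷-injectiveʳ)
open import Data.List using (List; _∷_; length; map)
open import Data.List.Properties using (length-map)
open import Data.List.Membership.Propositional using (_∈_)
open import Data.List.Membership.Propositional.Properties using (∈-map⁻)
import Data.List.Relation.Unary.Any as Any
import Data.List.Relation.Unary.All as All
import Data.List.Relation.Unary.All.Properties as All
open import Data.List.Relation.Unary.AllPairs using ([]; _∷_)
open import Data.List.Relation.Unary.Unique.Propositional using (Unique)
import Data.List.Relation.Unary.Unique.Propositional.Properties as Unique
open import Function using (_∘_)
open import Relation.Binary.PropositionalEquality
open import Relation.Nullary using (yes; no; contradiction)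

private
  variable
    n : ℕ
    p q : Subset n

x∈p─q⁻ : ∀ {x} → x ∈ₛ p ─ q → x ∈ₛ p × x ∉ₛ q
x∈p─q⁻ {p = inside  ∷ _} {q = outside ∷ _} here = here , λ ()
x∈p─q⁻ {p = outside ∷ _} {q = outside ∷ _} {zero} ()
x∈p─q⁻ {p = _       ∷ _} {q = inside  ∷ _} {zero} ()
x∈p─q⁻ {p = _ ∷ _} {q = _ ∷ _} (there x∈p─q) =
  let x∈p , x∉q = x∈p─q⁻ x∈p─q in there x∈p , x∉q ∘ drop-there

─-monoˡ-⊆ : ∀ r → p ⊆ q → p ─ r ⊆ q ─ r
─-monoˡ-⊆ _ p⊆q x∈p─r = let x∈p , x∉r = x∈p─q⁻ x∈p─r in x∈p∧x∉q⇒x∈p─q (p⊆q x∈p) x∉r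

─-monoʳ-⊆ : ∀ r → p ⊆ q → r ─ q ⊆ r ─ p
─-monoʳ-⊆ _ p⊆q x∈r─q = let x∈r , x∉q = x∈p─q⁻ x∈r─q in x∈p∧x∉q⇒x∈p─q x∈r (x∉q ∘ p⊆q)

p⊆q⇒∣p─q∣≡0 : p ⊆ q → ∣ p ─ q ∣ ≡ 0
p⊆q⇒∣p─q∣≡0 {n} {p} {q} p⊆q = trans (cong ∣_∣ (Empty-unique empty)) (∣⊥∣≡0 n)
  where
  empty : Empty (p ─ q)
  empty = λ (x , x∈p─q) → let x∈p , x∉q = x∈p─q⁻ x∈p─q in x∉q (p⊆q x∈p)

p≢q∧∣q∣≤∣p∣⇒0<∣p─q∣ : ∀ (p q : Subset n) → p ≢ q → ∣ q ∣ ≤ ∣ p ∣ → 0 < ∣ p ─ q ∣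
p≢q∧∣q∣≤∣p∣⇒0<∣p─q∣ []            []            p≢q _ = contradiction refl p≢q
p≢q∧∣q∣≤∣p∣⇒0<∣p─q∣ (inside  ∷ p) (outside ∷ q) _   _ = z<s
p≢q∧∣q∣≤∣p∣⇒0<∣p─q∣ (inside  ∷ p) (inside  ∷ q) p≢q (s≤s q≤p) =
  p≢q∧∣q∣≤∣p∣⇒0<∣p─q∣ p q (p≢q ∘ cong (inside ∷_)) q≤p
p≢q∧∣q∣≤∣p∣⇒0<∣p─q∣ (outside ∷ p) (outside ∷ q) p≢q q≤p =
  p≢q∧∣q∣≤∣p∣⇒0<∣p─q∣ p q (p≢q ∘ cong (outside ∷_)) q≤p
p≢q∧∣q∣≤∣p∣⇒0<∣p─q∣ (outside ∷ p) (inside  ∷ q) _   q<p =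
  p≢q∧∣q∣≤∣p∣⇒0<∣p─q∣ p q (λ { refl → n≮n _ q<p }) (<⇒≤ q<p)

∁p─∁q≡q─p : ∀ (p q : Subset n) → ∁ p ─ ∁ q ≡ q ─ p
∁p─∁q≡q─p []            []            = refl
∁p─∁q≡q─p (outside ∷ p) (outside ∷ q) = cong (outside ∷_) (∁p─∁q≡q─p p q)
∁p─∁q≡q─p (outside ∷ p) (inside  ∷ q) = cong (inside  ∷_) (∁p─∁q≡q─p p q)
∁p─∁q≡q─p (inside  ∷ p) (outside ∷ q) = cong (outside ∷_) (∁p─∁q≡q─p p q)
∁p─∁q≡q─p (inside  ∷ p) (inside  ∷ q) = cong (outside ∷_) (∁p─∁q≡q─p p q)

∁-injective : ∁ p ≡ ∁ q → p ≡ q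
∁-injective {n} {p} {q} ∁p≡∁q = begin
  p       ≡⟨ ¬-involutive p ⟨
  ∁ (∁ p) ≡⟨ cong ∁ ∁p≡∁q ⟩
  ∁ (∁ q) ≡⟨ ¬-involutive q ⟩
  q       ∎
  where
  open ≡-Reasoning
  open BooleanAlgebraProperties (∪-∩-booleanAlgebra n) using (¬-involutive)


-- The head of a vector is the element added last: a chain C₀ ⊂ … ⊂ Cₖ of the tail yields the
-- chains C₀ ⊂ … ⊂ Cₖ ⊂ Cₖ + x and C₀ + x ⊂ … ⊂ Cₖ₋₁ + x. gap p is the number of steps from p
-- to the top of its chain, and up p is the next set of the chain (junk at the top, gap p = 0).
gap : Subset n → ℕ
gap []            = 0
gap (outside ∷ p) = suc (gap p)
gap (inside  ∷ p) = pred (gap p)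

up : Subset n → Subset n
up []            = []
up (outside ∷ p) with gap p
... | zero  = inside ∷ p
... | suc _ = outside ∷ up p
up (inside  ∷ p) = inside ∷ up p

0<gap[inside∷p]⇒0<gap[p] : ∀ (p : Subset n) → 0 < gap (inside ∷ p) → 0 < gap p
0<gap[inside∷p]⇒0<gap[p] _ 0<gap = ≤-trans 0<gap pred[n]≤n

p⊆up[p] : ∀ (p : Subset n) → 0 < gap p → p ⊆ up p
p⊆up[p] (outside ∷ p) _ with gap p in eq
... | zero  = out⊆ ⊆-refl
... | suc _ = out⊆ (p⊆up[p] p (subst (0 <_) (sym eq) z<s))
p⊆up[p] (inside  ∷ p) 0<gap = in⊆in (p⊆up[p] p (0<gap[inside∷p]⇒0<gap[p] p 0<gap))

∣up[p]∣≡1+∣p∣ : ∀ (p : Subset n) → 0 < gap p → ∣ up p ∣ ≡ suc ∣ p ∣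
∣up[p]∣≡1+∣p∣ (outside ∷ p) _ with gap p in eq
... | zero  = refl
... | suc _ = ∣up[p]∣≡1+∣p∣ p (subst (0 <_) (sym eq) z<s)
∣up[p]∣≡1+∣p∣ (inside  ∷ p) 0<gap = cong suc (∣up[p]∣≡1+∣p∣ p (0<gap[inside∷p]⇒0<gap[p] p 0<gap))

gap[up[p]]≡pred[gap[p]] : ∀ (p : Subset n) → 0 < gap p → gap (up p) ≡ pred (gap p)
gap[up[p]]≡pred[gap[p]] (outside ∷ p) _ with gap p in eq
... | zero  = cong pred eq
... | suc _ = cong suc (trans (gap[up[p]]≡pred[gap[p]] p (subst (0 <_) (sym eq) z<s)) (cong pred eq))
gap[up[p]]≡pred[gap[p]] (inside  ∷ p) 0<gap =
  cong pred (gap[up[p]]≡pred[gap[p]] p (0<gap[inside∷p]⇒0<gap[p] p 0<gap))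

up-injective : ∀ (p q : Subset n) → 0 < gap p → 0 < gap q → up p ≡ up q → p ≡ q
up-injective []            []            _ _ _ = refl
up-injective (outside ∷ p) (outside ∷ q) _ _ up≡ with gap p in ep | gap q in eq
... | zero  | zero  = cong (outside ∷_) (∷-injectiveʳ up≡)
... | suc _ | suc _ = cong (outside ∷_)
  (up-injective p q (subst (0 <_) (sym ep) z<s) (subst (0 <_) (sym eq) z<s) (∷-injectiveʳ up≡))
... | zero  | suc _ = contradiction up≡ λ ()
... | suc _ | zero  = contradiction up≡ λ ()
up-injective (inside  ∷ p) (inside  ∷ q) 0<gap[p] 0<gap[q] up≡ = cong (inside ∷_)
  (up-injective p q (0<gap[inside∷p]⇒0<gap[p] p 0<gap[p]) (0<gap[inside∷p]⇒0<gap[p] q 0<gap[q])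
    (∷-injectiveʳ up≡))
up-injective (outside ∷ p) (inside  ∷ q) _ 0<gap[q] up≡ with gap p in ep
... | suc _ = contradiction up≡ λ ()
... | zero  = contradiction pred[gap[q]]≡0 (n>0⇒n≢0 0<gap[q])
  where
  open ≡-Reasoning
  pred[gap[q]]≡0 : pred (gap q) ≡ 0
  pred[gap[q]]≡0 = begin
    pred (gap q) ≡⟨ gap[up[p]]≡pred[gap[p]] q (0<gap[inside∷p]⇒0<gap[p] q 0<gap[q]) ⟨
    gap (up q)   ≡⟨ cong gap (∷-injectiveʳ up≡) ⟨
    gap p        ≡⟨ ep ⟩
    0            ∎
up-injective (inside  ∷ p) (outside ∷ q) 0<gap[p] 0<gap[q] up≡ =
  sym (up-injective (outside ∷ q) (inside ∷ p) 0<gap[q] 0<gap[p] (sym up≡))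

n≤∣p∣+[∣p∣+gap[p]] : ∀ (p : Subset n) → n ≤ ∣ p ∣ + (∣ p ∣ + gap p)
n≤∣p∣+[∣p∣+gap[p]] []            = z≤n
n≤∣p∣+[∣p∣+gap[p]] {suc n} (outside ∷ p) = begin
  suc n                               ≤⟨ s≤s (n≤∣p∣+[∣p∣+gap[p]] p) ⟩
  suc (∣ p ∣ + (∣ p ∣ + gap p))       ≡⟨ +-suc ∣ p ∣ _ ⟨
  ∣ p ∣ + suc (∣ p ∣ + gap p)         ≡⟨ cong (∣ p ∣ +_) (+-suc ∣ p ∣ (gap p)) ⟨
  ∣ p ∣ + (∣ p ∣ + suc (gap p))       ∎
  where open ≤-Reasoning
n≤∣p∣+[∣p∣+gap[p]] {suc n} (inside  ∷ p) = s≤s (begin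
  n                                   ≤⟨ n≤∣p∣+[∣p∣+gap[p]] p ⟩
  ∣ p ∣ + (∣ p ∣ + gap p)             ≤⟨ +-monoʳ-≤ ∣ p ∣ (+-monoʳ-≤ ∣ p ∣ (m≤1+pred[m] (gap p))) ⟩
  ∣ p ∣ + (∣ p ∣ + suc (pred (gap p))) ≡⟨ cong (∣ p ∣ +_) (+-suc ∣ p ∣ _) ⟩
  ∣ p ∣ + suc (∣ p ∣ + pred (gap p))  ∎)
  where
  open ≤-Reasoning
  m≤1+pred[m] : ∀ m → m ≤ suc (pred m)
  m≤1+pred[m] zero    = z≤n
  m≤1+pred[m] (suc m) = ≤-refl

2*∣p∣<n⇒0<gap[p] : ∀ (p : Subset n) → 2 * ∣ p ∣ < n → 0 < gap p
2*∣p∣<n⇒0<gap[p] {n} p 2∣p∣<n = n≢0⇒n>0 λ gap≡0 →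
  <⇒≱ 2∣p∣<n (subst (λ g → n ≤ ∣ p ∣ + (∣ p ∣ + g)) gap≡0 (n≤∣p∣+[∣p∣+gap[p]] p))


record DifferenceCondition (s : ℕ) : Set₁ where
  field
    Holds    : ℕ → ℕ → Set
    positive : ∀ {a b} → Holds a b → 0 < a
    intro    : ∀ {a b} → 0 < a → a ≤ s → 0 < b → Holds a b
    shrinkˡ  : ∀ {a b a′ b′} → Holds a b → a′ ≤ a → 0 < a′ → 0 < b′ → b′ ≤ s → Holds a′ b′

  equal-size⇒Holds : ∀ (p q : Subset n) → ∣ p ∣ ≡ ∣ q ∣ → ∣ p ∣ ≤ s → p ≢ q → Holds (∣ p ─ q ∣) (∣ q ─ p ∣)
  equal-size⇒Holds p q ∣p∣≡∣q∣ ∣p∣≤s p≢q = intro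
    (p≢q∧∣q∣≤∣p∣⇒0<∣p─q∣ p q p≢q (≤-reflexive (sym ∣p∣≡∣q∣)))
    (≤-trans (∣p─q∣≤∣p∣ p q) ∣p∣≤s)
    (p≢q∧∣q∣≤∣p∣⇒0<∣p─q∣ q p (≢-sym p≢q) (≤-reflexive ∣p∣≡∣q∣))

closeCondition : ∀ s → DifferenceCondition s
closeCondition s = record
  { Holds    = λ a b → InInterval s (a ⊓ b)
  ; positive = λ (0<a⊓b , _) → ≤-trans 0<a⊓b (m⊓n≤m _ _)
  ; intro    = λ 0<a a≤s 0<b → ⊓-glb 0<a 0<b , ≤-trans (m⊓n≤m _ _) a≤s
  ; shrinkˡ  = λ _ _ 0<a′ 0<b′ b′≤s → ⊓-glb 0<a′ 0<b′ , ≤-trans (m⊓n≤n _ _) b′≤s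
  }

differencingCondition : ∀ s → DifferenceCondition s
differencingCondition s = record
  { Holds    = λ a _ → InInterval s a
  ; positive = proj₁
  ; intro    = λ 0<a a≤s _ → 0<a , a≤s
  ; shrinkˡ  = λ (_ , a≤s) a′≤a 0<a′ _ _ → 0<a′ , ≤-trans a′≤a a≤s
  }

module _ {s : ℕ} (C : DifferenceCondition s) where
  open DifferenceCondition C

  Satisfies : List (Subset n) → Set
  Satisfies F = ∀ {A B} → A ∈ F → B ∈ F → A ≢ B → Holds (∣ A ─ B ∣) (∣ B ─ A ∣)

  satisfies-map : ∀ (f : Subset n → Subset n) {F : List (Subset n)} →
                  (∀ {A B} → A ∈ F → B ∈ F → f A ≢ f B → Holds (∣ f A ─ f B ∣) (∣ f B ─ f A ∣)) →
                  Satisfies (map f F)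
  satisfies-map f pairs fA∈ fB∈ fA≢fB with ∈-map⁻ f fA∈ | ∈-map⁻ f fB∈
  ... | _ , A∈F , refl | _ , B∈F , refl = pairs A∈F B∈F fA≢fB

SizesBetween : ℕ → ℕ → List (Subset n) → Set
SizesBetween l u F = ∀ {A} → A ∈ F → l ≤ ∣ A ∣ × ∣ A ∣ ≤ u

sizesBetween-map : ∀ {l u} (f : Subset n → Subset n) {F : List (Subset n)} →
                   (∀ {A} → A ∈ F → l ≤ ∣ f A ∣ × ∣ f A ∣ ≤ u) → SizesBetween l u (map f F)
sizesBetween-map f bounds fA∈ with ∈-map⁻ f fA∈
... | _ , A∈F , refl = bounds A∈F

unique-map⁺ : ∀ {X Y : Set} (f : X → Y) {xs : List X} →
              (∀ {x y} → x ∈ xs → y ∈ xs → f x ≡ f y → x ≡ y) → Unique xs → Unique (map f xs)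
unique-map⁺ f inj []           = []
unique-map⁺ f inj (x∉xs ∷ xs!) =
  All.map⁺ (All.tabulate λ y∈xs fx≡fy → All.lookup x∉xs y∈xs (inj (Any.here refl) (Any.there y∈xs) fx≡fy))
  ∷ unique-map⁺ f (λ x∈xs y∈xs → inj (Any.there x∈xs) (Any.there y∈xs)) xs!

Admissible : ∀ {s} → DifferenceCondition s → ℕ → ℕ → List (Subset n) → Set
Admissible C l u F = Unique F × Satisfies C F × SizesBetween l u F

admissible-mono : ∀ {s} (C : DifferenceCondition s) {l l′ u u′} {F : List (Subset n)} →
                  l′ ≤ l → u ≤ u′ → Admissible C l u F → Admissible C l′ u′ F
admissible-mono _ l′≤l u≤u′ (F! , sat , sizes) =
  F! , sat , λ A∈F → let l≤ , ≤u = sizes A∈F in ≤-trans l′≤l l≤ , ≤-trans ≤u u≤u′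

∁-admissible : ∀ {s} (C : DifferenceCondition s) {l u} {F : List (Subset n)} →
               Admissible C l u F → Admissible C (n ∸ u) (n ∸ l) (map ∁ F)
∁-admissible {n} C {l} {u} {F} (F! , sat , sizes) =
  Unique.map⁺ ∁-injective F! , satisfies-map C ∁ pairs , sizesBetween-map ∁ bounds
  where
  open DifferenceCondition C
  pairs : ∀ {A B} → A ∈ F → B ∈ F → ∁ A ≢ ∁ B → Holds (∣ ∁ A ─ ∁ B ∣) (∣ ∁ B ─ ∁ A ∣)
  pairs {A} {B} A∈F B∈F ∁A≢∁B =
    subst₂ Holds (cong ∣_∣ (sym (∁p─∁q≡q─p A B))) (cong ∣_∣ (sym (∁p─∁q≡q─p B A)))
      (sat B∈F A∈F (∁A≢∁B ∘ cong ∁ ∘ sym))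
  bounds : ∀ {A} → A ∈ F → n ∸ u ≤ ∣ ∁ A ∣ × ∣ ∁ A ∣ ≤ n ∸ l
  bounds {A} A∈F rewrite ∣∁p∣≡n∸∣p∣ A =
    let l≤∣A∣ , ∣A∣≤u = sizes A∈F in ∸-monoʳ-≤ n ∣A∣≤u , ∸-monoʳ-≤ n l≤∣A∣


lift : ℕ → Subset n → Subset n
lift t A with ∣ A ∣ ≟ t
... | yes _ = up A
... | no  _ = A

data LiftView (t : ℕ) (A : Subset n) : Subset n → Set where
  raised : ∣ A ∣ ≡ t → LiftView t A (up A)
  kept   : ∣ A ∣ ≢ t → LiftView t A A

liftView : ∀ t (A : Subset n) → LiftView t A (lift t A)
liftView t A with ∣ A ∣ ≟ t
... | yes ∣A∣≡t = raised ∣A∣≡t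
... | no  ∣A∣≢t = kept ∣A∣≢t

module _ {n s : ℕ} (C : DifferenceCondition s) {t u : ℕ}
         (t<s : t < s) (2t<n : 2 * t < n) (t<u : t < u) where
  open DifferenceCondition C

  private
    0<gap : ∀ (A : Subset n) → ∣ A ∣ ≡ t → 0 < gap A
    0<gap A ∣A∣≡t = 2*∣p∣<n⇒0<gap[p] A (subst (λ k → 2 * k < n) (sym ∣A∣≡t) 2t<n)

    ∣up∣≡1+t : ∀ (A : Subset n) → ∣ A ∣ ≡ t → ∣ up A ∣ ≡ suc t
    ∣up∣≡1+t A ∣A∣≡t = trans (∣up[p]∣≡1+∣p∣ A (0<gap A ∣A∣≡t)) (cong suc ∣A∣≡t)

    ∣up∣≤s : ∀ (A : Subset n) → ∣ A ∣ ≡ t → ∣ up A ∣ ≤ s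
    ∣up∣≤s A ∣A∣≡t = ≤-trans (≤-reflexive (∣up∣≡1+t A ∣A∣≡t)) t<s

    ≢-by-size : ∀ {A B : Subset n} → ∣ A ∣ ≡ t → ∣ B ∣ ≢ t → A ≢ B
    ≢-by-size ∣A∣≡t ∣B∣≢t refl = ∣B∣≢t ∣A∣≡t

  module _ {F : List (Subset n)} (sat : Satisfies C F) (sizes : SizesBetween t u F) where
    private
      t<∣B∣ : ∀ {B} → B ∈ F → ∣ B ∣ ≢ t → t < ∣ B ∣
      t<∣B∣ B∈F ∣B∣≢t = ≤∧≢⇒< (proj₁ (sizes B∈F)) (≢-sym ∣B∣≢t)

      raised≢kept : ∀ {A B} → A ∈ F → B ∈ F → ∣ A ∣ ≡ t → ∣ B ∣ ≢ t → up A ≢ B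
      raised≢kept {A} A∈F B∈F ∣A∣≡t ∣B∣≢t upA≡B =
        n>0⇒n≢0 (positive (sat A∈F B∈F (≢-by-size ∣A∣≡t ∣B∣≢t)))
                (p⊆q⇒∣p─q∣≡0 (subst (A ⊆_) upA≡B (p⊆up[p] A (0<gap A ∣A∣≡t))))

      raised-vs-kept : ∀ {A B} → A ∈ F → B ∈ F → ∣ A ∣ ≡ t → ∣ B ∣ ≢ t →
                       Holds (∣ up A ─ B ∣) (∣ B ─ up A ∣) × Holds (∣ B ─ up A ∣) (∣ up A ─ B ∣)
      raised-vs-kept {A} {B} A∈F B∈F ∣A∣≡t ∣B∣≢t =
        intro 0<∣A′─B∣ ∣A′─B∣≤s 0<∣B─A′∣ ,
        shrinkˡ (sat B∈F A∈F (≢-sym A≢B)) ∣B─A′∣≤∣B─A∣ 0<∣B─A′∣ 0<∣A′─B∣ ∣A′─B∣≤s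
        where
        A≢B : A ≢ B
        A≢B = ≢-by-size ∣A∣≡t ∣B∣≢t
        A⊆A′ : A ⊆ up A
        A⊆A′ = p⊆up[p] A (0<gap A ∣A∣≡t)
        0<∣A′─B∣ : 0 < ∣ up A ─ B ∣
        0<∣A′─B∣ = ≤-trans (positive (sat A∈F B∈F A≢B)) (p⊆q⇒∣p∣≤∣q∣ (─-monoˡ-⊆ B A⊆A′))
        ∣A′─B∣≤s : ∣ up A ─ B ∣ ≤ s
        ∣A′─B∣≤s = ≤-trans (∣p─q∣≤∣p∣ (up A) B) (∣up∣≤s A ∣A∣≡t)
        0<∣B─A′∣ : 0 < ∣ B ─ up A ∣
        0<∣B─A′∣ = p≢q∧∣q∣≤∣p∣⇒0<∣p─q∣ B (up A) (≢-sym (raised≢kept A∈F B∈F ∣A∣≡t ∣B∣≢t))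
                     (≤-trans (≤-reflexive (∣up∣≡1+t A ∣A∣≡t)) (t<∣B∣ B∈F ∣B∣≢t))
        ∣B─A′∣≤∣B─A∣ : ∣ B ─ up A ∣ ≤ ∣ B ─ A ∣
        ∣B─A′∣≤∣B─A∣ = p⊆q⇒∣p∣≤∣q∣ (─-monoʳ-⊆ B A⊆A′)

    lift-injective : ∀ {A B} → A ∈ F → B ∈ F → lift t A ≡ lift t B → A ≡ B
    lift-injective {A} {B} A∈F B∈F A′≡B′ with lift t A | liftView t A | lift t B | liftView t B
    ... | _ | raised ∣A∣≡t | _ | raised ∣B∣≡t = up-injective A B (0<gap A ∣A∣≡t) (0<gap B ∣B∣≡t) A′≡B′
    ... | _ | raised ∣A∣≡t | _ | kept   ∣B∣≢t = contradiction A′≡B′ (raised≢kept A∈F B∈F ∣A∣≡t ∣B∣≢t)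
    ... | _ | kept   ∣A∣≢t | _ | raised ∣B∣≡t = contradiction (sym A′≡B′) (raised≢kept B∈F A∈F ∣B∣≡t ∣A∣≢t)
    ... | _ | kept   _     | _ | kept   _     = A′≡B′

    lift-satisfies : Satisfies C (map (lift t) F)
    lift-satisfies = satisfies-map C (lift t) pairs
      where
      pairs : ∀ {A B} → A ∈ F → B ∈ F → lift t A ≢ lift t B →
              Holds (∣ lift t A ─ lift t B ∣) (∣ lift t B ─ lift t A ∣)
      pairs {A} {B} A∈F B∈F A′≢B′ with lift t A | liftView t A | lift t B | liftView t B
      ... | _ | raised ∣A∣≡t | _ | raised ∣B∣≡t = equal-size⇒Holds (up A) (up B)
        (trans (∣up∣≡1+t A ∣A∣≡t) (sym (∣up∣≡1+t B ∣B∣≡t))) (∣up∣≤s A ∣A∣≡t) A′≢B′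
      ... | _ | raised ∣A∣≡t | _ | kept   ∣B∣≢t = proj₁ (raised-vs-kept A∈F B∈F ∣A∣≡t ∣B∣≢t)
      ... | _ | kept   ∣A∣≢t | _ | raised ∣B∣≡t = proj₂ (raised-vs-kept B∈F A∈F ∣B∣≡t ∣A∣≢t)
      ... | _ | kept   _     | _ | kept   _     = sat A∈F B∈F A′≢B′

    lift-sizes : SizesBetween (suc t) u (map (lift t) F)
    lift-sizes = sizesBetween-map (lift t) bounds
      where
      bounds : ∀ {A} → A ∈ F → suc t ≤ ∣ lift t A ∣ × ∣ lift t A ∣ ≤ u
      bounds {A} A∈F with lift t A | liftView t A
      ... | _ | raised ∣A∣≡t = ≤-reflexive (sym (∣up∣≡1+t A ∣A∣≡t)) , ≤-trans (≤-reflexive (∣up∣≡1+t A ∣A∣≡t)) t<u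
      ... | _ | kept   ∣A∣≢t = t<∣B∣ A∈F ∣A∣≢t , proj₂ (sizes A∈F)

  lift-admissible : ∀ {F : List (Subset n)} → Admissible C t u F → Admissible C (suc t) u (map (lift t) F)
  lift-admissible (F! , sat , sizes) =
    unique-map⁺ (lift t) (lift-injective sat sizes) F! , lift-satisfies sat sizes , lift-sizes sat sizes

raiseTo : ℕ → List (Subset n) → List (Subset n)
raiseTo zero    F = F
raiseTo (suc t) F = map (lift t) (raiseTo t F)

length-raiseTo : ∀ t (F : List (Subset n)) → length (raiseTo t F) ≡ length F
length-raiseTo zero    F = refl
length-raiseTo (suc t) F = trans (length-map (lift t) (raiseTo t F)) (length-raiseTo t F)

raiseTo-admissible : ∀ {s} (C : DifferenceCondition s) {u} {F : List (Subset n)} t →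
                     t ≤ s → 2 * s ≤ n → s ≤ u → Admissible C 0 u F → Admissible C t u (raiseTo t F)
raiseTo-admissible C zero    _   _    _   adm = adm
raiseTo-admissible C (suc t) t<s 2s≤n s≤u adm =
  lift-admissible C t<s (<-≤-trans (*-monoʳ-< 2 t<s) 2s≤n) (<-≤-trans t<s s≤u)
    (raiseTo-admissible C t (<⇒≤ t<s) 2s≤n s≤u adm)

exists-middle-sized : ∀ {n s} (C : DifferenceCondition s) → 2 * s ≤ n →
  (F : List (Subset n)) → Unique F → Satisfies C F →
  Σ[ F′ ∈ List (Subset n) ] (Unique F′ × length F′ ≡ length F × MiddleSized s F′ × Satisfies C F′)
exists-middle-sized {n} {s} C 2s≤n F F! sat =
  let F′! , sat′ , middle = F′-admissible in F′ , F′! , length-F′ , middle , sat′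
  where
  s≤n : s ≤ n
  s≤n = m+n≤o⇒m≤o s 2s≤n
  s≤n∸s : s ≤ n ∸ s
  s≤n∸s = m+n≤o⇒m≤o∸n s (subst (_≤ n) (cong (s +_) (+-identityʳ s)) 2s≤n)

  F′ : List (Subset n)
  F′ = map ∁ (raiseTo s (map ∁ (raiseTo s F)))

  below-raised : Admissible C 0 (n ∸ s) (map ∁ (raiseTo s F))
  below-raised = admissible-mono C z≤n ≤-refl (∁-admissible C
    (raiseTo-admissible C s ≤-refl 2s≤n s≤n (F! , sat , λ {A} _ → z≤n , ∣p∣≤n A)))

  F′-admissible : Admissible C s (n ∸ s) F′
  F′-admissible = admissible-mono C (≤-reflexive (sym (m∸[m∸n]≡n s≤n))) ≤-refl (∁-admissible C
    (raiseTo-admissible C s ≤-refl 2s≤n s≤n∸s below-raised))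

  length-F′ : length F′ ≡ length F
  length-F′ = begin
    length F′                                    ≡⟨ length-map ∁ (raiseTo s (map ∁ (raiseTo s F))) ⟩
    length (raiseTo s (map ∁ (raiseTo s F)))     ≡⟨ length-raiseTo s (map ∁ (raiseTo s F)) ⟩
    length (map ∁ (raiseTo s F))                 ≡⟨ length-map ∁ (raiseTo s F) ⟩
    length (raiseTo s F)                         ≡⟨ length-raiseTo s F ⟩
    length F                                     ∎
    where open ≡-Reasoning

corollary3p3 :
    (n s : ℕ) → 1 ≤ n → 1 ≤ s → 2 * s ≤ n →
    ((F : List (Subset n)) → Unique F → CloseSperner s F →
      Σ[ F′ ∈ List (Subset n) ]
        (Unique F′ × length F′ ≡ length F × MiddleSized s F′ × CloseSperner s F′))
    × ((F : List (Subset n)) → Unique F → DifferencingSperner s F →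
      Σ[ F′ ∈ List (Subset n) ]
        (Unique F′ × length F′ ≡ length F × MiddleSized s F′ × DifferencingSperner s F′))
corollary3p3 n s _ _ 2s≤n =
  exists-middle-sized (closeCondition s) 2s≤n , exists-middle-sized (differencingCondition s) 2s≤n
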